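{- Let $n$ be an odd positive integer and $k\geq 3$ an odd integer such that $k\equiv 0\pmod n$. Let $S_k(n):=1^k+2^k+\cdots+n^k$. Then \[ S_k(n)\equiv 0\pmod{n^2}. \] -}

module Defs where

open import Data.Nat using (ℕ; zero; suc; _+_; _^_)

S : ℕ → ℕ → ℕ
S k zero    = 0
S k (suc n) = S k n + suc n ^ k

open import Data.Nat.DivMod using (_%_)
open import Relation.Binary.PropositionalEquality using (_≡_)

Odd : ℕ → Set
Odd n = n % 2 ≡ 1

module Submission where

-- Pair x with n − x.  As y = −x + n, the binomial theorem gives
-- y^k ≡ (−x)^k + k·n·(−x)^(k−1) ≡ −x^k (mod n²), because k is odd and n ∣ k.
-- Summing the pairs over 1 ≤ x ≤ n − 1 shows n² ∣ 2·S k (n − 1), hence n² ∣ S k (n − 1)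
-- since n is odd, and the last term n^k is divisible by n² because k ≥ 2.

open import Defs
import Data.Nat as ℕ
import Data.Nat.Properties as ℕP
open import Data.Product using (∃-syntax; _,_)
open import Relation.Binary.PropositionalEquality
  using (_≡_; refl; sym; trans; cong; cong₂; subst; subst₂; module ≡-Reasoning)

module _ where
  open import Data.Integer.Base using (ℤ; +_; -_; _+_; _-_; _*_; _^_; 0ℤ; 1ℤ)
  open import Data.Integer.Properties
    using (pos-*; +-identityʳ; neg-distribˡ-*; neg-involutive; ^-*-assoc)
  open import Data.Integer.Divisibility.Signed
    using (_∣_; divides; ∣-refl; ∣m∣n⇒∣m+n; ∣n⇒∣m*n; ∣m⇒∣m*n; module ∣-Reasoning)
  open import Data.Integer.Tactic.RingSolver using (solve-∀)

  pos-^ : ∀ m n → + (m ℕ.^ n) ≡ (+ m) ^ n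
  pos-^ m ℕ.zero    = refl
  pos-^ m (ℕ.suc n) = trans (pos-* m (m ℕ.^ n)) (cong (+ m *_) (pos-^ m n))

  square-neg : ∀ x → (- x) ^ 2 ≡ x ^ 2
  square-neg x = lemma x
    where
    lemma : ∀ x → - x * (- x * 1ℤ) ≡ x * (x * 1ℤ)
    lemma = solve-∀

  neg-^-odd : ∀ x j → (- x) ^ ℕ.suc (2 ℕ.* j) ≡ - (x ^ ℕ.suc (2 ℕ.* j))
  neg-^-odd x j = begin
    - x * (- x) ^ (2 ℕ.* j) ≡⟨ cong (- x *_) (^-*-assoc (- x) 2 j) ⟨
    - x * ((- x) ^ 2) ^ j   ≡⟨ cong (λ s → - x * s ^ j) (square-neg x) ⟩
    - x * (x ^ 2) ^ j       ≡⟨ cong (- x *_) (^-*-assoc x 2 j) ⟩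
    - x * x ^ (2 ℕ.* j)     ≡⟨ neg-distribˡ-* x (x ^ (2 ℕ.* j)) ⟨
    - (x * x ^ (2 ℕ.* j))   ∎
    where open ≡-Reasoning

  binomial-mod-square : ∀ m (x d : ℤ) →
    d * d ∣ (x + d) ^ ℕ.suc m - (x ^ ℕ.suc m + + ℕ.suc m * d * x ^ m)
  binomial-mod-square ℕ.zero x d = divides 0ℤ (linear x d)
    where
    linear : ∀ x d → (x + d) * 1ℤ - (x * 1ℤ + 1ℤ * d * 1ℤ) ≡ 0ℤ * (d * d)
    linear = solve-∀
  binomial-mod-square (ℕ.suc m) x d = begin
    d * d
      ∣⟨ ∣m∣n⇒∣m+n (∣n⇒∣m*n (x + d) (binomial-mod-square m x d))
                   (∣m⇒∣m*n (+ ℕ.suc m * x ^ m) ∣-refl) ⟩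
    (x + d) * ((x + d) ^ ℕ.suc m - (x ^ ℕ.suc m + + ℕ.suc m * d * x ^ m))
      + d * d * (+ ℕ.suc m * x ^ m)
      ≡⟨ step x d ((x + d) ^ ℕ.suc m) (x ^ m) (+ ℕ.suc m) ⟩
    (x + d) ^ ℕ.suc (ℕ.suc m) - (x ^ ℕ.suc (ℕ.suc m) + + ℕ.suc (ℕ.suc m) * d * x ^ ℕ.suc m) ∎
    where
    open ∣-Reasoning
    step : ∀ x d P X M →
      (x + d) * (P - (x * X + M * d * X)) + d * d * (M * X)
        ≡ (x + d) * P - (x * (x * X) + (+ 1 + M) * d * (x * X))
    step = solve-∀

  [x+y]²∣x^odd+y^odd : ∀ j {x y} → x + y ∣ + ℕ.suc (2 ℕ.* j) →
    (x + y) * (x + y) ∣ x ^ ℕ.suc (2 ℕ.* j) + y ^ ℕ.suc (2 ℕ.* j)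
  [x+y]²∣x^odd+y^odd j {x} {y} (divides c k≡c*n) = begin
    n * n
      ∣⟨ ∣m∣n⇒∣m+n (binomial-mod-square (2 ℕ.* j) (- x) n) n*n∣k*n*P ⟩
    (- x + n) ^ k - ((- x) ^ k + + k * n * P) + + k * n * P
      ≡⟨ cancel ((- x + n) ^ k) ((- x) ^ k) (+ k * n * P) ⟩
    - (- x) ^ k + (- x + n) ^ k
      ≡⟨ cong₂ _+_ (trans (cong -_ (neg-^-odd x j)) (neg-involutive (x ^ k)))
                   (cong (_^ k) (-x+[x+y]≡y x y)) ⟩
    x ^ k + y ^ k ∎
    where
    open ∣-Reasoning
    n = x + y
    k = ℕ.suc (2 ℕ.* j)
    P = (- x) ^ (2 ℕ.* j)
    n*n∣k*n*P : n * n ∣ + k * n * P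
    n*n∣k*n*P = divides (c * P) (trans (cong (λ K → K * n * P) k≡c*n) (regroup c n P))
      where
      regroup : ∀ c n P → c * n * n * P ≡ c * P * (n * n)
      regroup = solve-∀
    cancel : ∀ A B C → A - (B + C) + C ≡ - B + A
    cancel = solve-∀
    -x+[x+y]≡y : ∀ x y → - x + (x + y) ≡ y
    -x+[x+y]≡y = solve-∀

  ∣-pairs⇒∣S+S : ∀ {d} k m → (∀ x y → x ℕ.+ y ≡ ℕ.suc m → d ∣ + (x ℕ.^ k ℕ.+ y ℕ.^ k)) →
    d ∣ + (S k m ℕ.+ S k m)
  ∣-pairs⇒∣S+S {d} k m pair-∣ = begin
    d                             ∣⟨ partial-∣ m 0 (ℕP.+-identityʳ m) ⟩
    + S k m + (+ S k m - + S k 0) ≡⟨ cong (λ t → + S k m + t) (+-identityʳ (+ S k m)) ⟩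
    + S k m + + S k m             ∎
    where
    open ∣-Reasoning
    -- S a + (S m − S b) is the sum of the pairs x^k + (m + 1 − x)^k for 1 ≤ x ≤ a.
    partial-∣ : ∀ a b → a ℕ.+ b ≡ m → d ∣ + S k a + (+ S k m - + S k b)
    partial-∣ ℕ.zero    b refl = divides 0ℤ (vanish (+ S k b) d)
      where
      vanish : ∀ s d → 0ℤ + (s - s) ≡ 0ℤ * d
      vanish = solve-∀
    partial-∣ (ℕ.suc a) b a+1+b≡m = begin
      d
        ∣⟨ ∣m∣n⇒∣m+n (partial-∣ a (ℕ.suc b) a+[1+b]≡m)
                     (pair-∣ (ℕ.suc a) (ℕ.suc b) (cong ℕ.suc a+[1+b]≡m)) ⟩
      (+ S k a + (+ S k m - (+ S k b + + A))) + (+ B + + A)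
        ≡⟨ regroup (+ S k a) (+ S k m) (+ S k b) (+ B) (+ A) ⟩
      (+ S k a + + B) + (+ S k m - + S k b) ∎
      where
      A = ℕ.suc b ℕ.^ k
      B = ℕ.suc a ℕ.^ k
      a+[1+b]≡m = trans (ℕP.+-suc a b) a+1+b≡m
      regroup : ∀ sa sm sb B A → (sa + (sm - (sb + A))) + (B + A) ≡ (sa + B) + (sm - sb)
      regroup = solve-∀

open import Data.Nat using (ℕ; zero; suc; _+_; _*_; _^_; _≤_; _≥_; s≤s)
open import Data.Nat.Properties using (*-comm; *-assoc; <⇒≤)
open import Data.Nat.DivMod using (_/_; _%_; m≡m%n+[m/n]*n; %-distribˡ-*)
open import Data.Nat.Divisibility using (_∣_; ∣m∣n⇒∣m+n; ∣m+n∣m⇒∣n; n∣m*n; m∣m*n; ∣n⇒∣m*n)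
open import Data.Nat.Tactic.RingSolver using (solve-∀)
import Data.Integer.Base as ℤ
import Data.Integer.Properties as ℤP
open import Data.Integer.Divisibility.Signed using (∣ᵤ⇒∣; ∣⇒∣ᵤ)

Odd⇒≡1+2* : ∀ {n} → Odd n → ∃[ q ] n ≡ suc (2 * q)
Odd⇒≡1+2* {n} odd = n / 2 , (begin
  n                 ≡⟨ m≡m%n+[m/n]*n n 2 ⟩
  n % 2 + n / 2 * 2 ≡⟨ cong₂ _+_ odd (*-comm (n / 2) 2) ⟩
  suc (2 * (n / 2)) ∎)
  where open ≡-Reasoning

Odd-* : ∀ {m n} → Odd m → Odd n → Odd (m * n)
Odd-* {m} {n} odd-m odd-n =
  trans (%-distribˡ-* m n 2) (cong₂ (λ a b → (a * b) % 2) odd-m odd-n)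

∣m+m⇒∣m : ∀ {d m} → Odd d → d ∣ m + m → d ∣ m
∣m+m⇒∣m {d} {m} odd d∣m+m with Odd⇒≡1+2* {d} odd
... | q , refl = ∣m+n∣m⇒∣n (subst (suc (2 * q) ∣_) (split m q) (n∣m*n m)) (∣n⇒∣m*n q d∣m+m)
  where
  split : ∀ m q → m * suc (2 * q) ≡ q * (m + m) + m
  split = solve-∀

m*m∣m^n : ∀ m {n} → 2 ≤ n → m * m ∣ m ^ n
m*m∣m^n m {suc (suc n)} (s≤s (s≤s _)) = subst (m * m ∣_) (*-assoc m m (m ^ n)) (m∣m*n (m ^ n))

n²∣x^k+y^k : ∀ {n k} x y → Odd k → x + y ≡ n → n ∣ k → n * n ∣ x ^ k + y ^ k
n²∣x^k+y^k {k = k} x y odd refl n∣k with Odd⇒≡1+2* {k} odd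
... | j , refl = subst₂ _∣_ (ℤP.abs-* (ℤ.+ (x + y)) (ℤ.+ (x + y)))
  (cong₂ (λ a b → ℤ.∣ a ℤ.+ b ∣) (sym (pos-^ x (suc (2 * j)))) (sym (pos-^ y (suc (2 * j)))))
  (∣⇒∣ᵤ ([x+y]²∣x^odd+y^odd j {ℤ.+ x} {ℤ.+ y} (∣ᵤ⇒∣ n∣k)))

proposition3p1 : (n k : ℕ) → Odd n → Odd k → k ≥ 3 → n ∣ k → n * n ∣ S k n
proposition3p1 zero      k ()    _     _   _
proposition3p1 n@(suc m) k odd-n odd-k k≥3 n∣k = ∣m∣n⇒∣m+n n²∣S[n-1] (m*m∣m^n n (<⇒≤ k≥3))
  where
  n²∣S[n-1] : n * n ∣ S k m
  n²∣S[n-1] = ∣m+m⇒∣m (Odd-* {n} {n} odd-n odd-n)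
    (∣⇒∣ᵤ (∣-pairs⇒∣S+S {ℤ.+ (n * n)} k m λ x y x+y≡n → ∣ᵤ⇒∣ (n²∣x^k+y^k x y odd-k x+y≡n n∣k)))
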